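{- Let $n \geq 2$ and $\Delta \geq 2$ be integers, and let $T$ be a tree with maximal $F$-index among all trees with $n$ vertices and maximal degree at most $\Delta$. Then: (i) if $(n-2) \bmod (\Delta-1) = 0$, then $F(T) = \Delta(\Delta+1)(n-2) + 2(n-1)$; (ii) otherwise, $F(T) = (\Delta^2+\Delta+2)(n-1) - (\Delta^2+\Delta+1)x + x^3$, where $x$ is the unique integer with $2 \leq x \leq \Delta-1$ and $(n-1-x) \bmod (\Delta-1) = 0$.
   Context: For a graph $G$ with vertex set $V(G)$, $d(v)$ denotes the degree of a vertex $v$. The $F$-index (forgotten topological index) of $G$ is $F(G)=\sum_{v\in V(G)} d(v)^3$. The maximal degree of a graph is the largest degree of its vertices. -}

module Defs where

open import Data.Nat using (ℕ; suc; _^_; _≤_)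
open import Data.Bool using (Bool; true; false)
open import Data.Fin using (Fin)
open import Data.List using (List; []; _∷_; length; filterᵇ; map; allFin)
open import Data.Nat.ListAction using (sum)
open import Data.List.Relation.Unary.Unique.Propositional using (Unique)
open import Data.Product using (∃)
open import Relation.Nullary using (¬_)
open import Relation.Binary.PropositionalEquality using (_≡_)

record Graph (n : ℕ) : Set where
  field
    adj     : Fin n → Fin n → Bool
    sym     : ∀ u v → adj u v ≡ adj v u
    irrefl  : ∀ v → adj v v ≡ false
open Graph public

Adj : ∀ {n} → Graph n → Fin n → Fin n → Set
Adj G u v = adj G u v ≡ true

degree : ∀ {n} → Graph n → Fin n → ℕ
degree {n} G v = length (filterᵇ (adj G v) (allFin n))

MaxDegreeAtMost : ∀ {n} → Graph n → ℕ → Set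
MaxDegreeAtMost G Δ = ∀ v → degree G v ≤ Δ

Findex : ∀ {n} → Graph n → ℕ
Findex {n} G = sum (map (λ v → degree G v ^ 3) (allFin n))

data Walk {n} (G : Graph n) : Fin n → Fin n → Set where
  here  : ∀ {v} → Walk G v v
  step  : ∀ {u w v} → Adj G u w → Walk G w v → Walk G u v

Connected : ∀ {n} → Graph n → Set
Connected G = ∀ u v → Walk G u v

data IsPathFrom {n} (G : Graph n) : Fin n → List (Fin n) → Fin n → Set where
  end  : ∀ {v} → IsPathFrom G v [] v
  cons : ∀ {u w vs l} → Adj G u w → IsPathFrom G w vs l → IsPathFrom G u (w ∷ vs) l

record Cycle {n} (G : Graph n) : Set where
  field
    u w x last : Fin n
    vs         : List (Fin n)
    path       : IsPathFrom G u (w ∷ x ∷ vs) last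
    distinct   : Unique (u ∷ w ∷ x ∷ vs)
    closing    : Adj G last u

Acyclic : ∀ {n} → Graph n → Set
Acyclic G = ¬ Cycle G

IsTree : ∀ {n} → Graph n → Set
IsTree G = Connected G × Acyclic G
  where open import Data.Product using (_×_)

-- Write the degrees of a tree T on n = j + 2 vertices as d_v = 1 + e_v. Then 0 ≤ e_v ≤ Δ − 1 = m,
-- Σ e_v ≤ n − 2 = j (a forest on n vertices has at most n − 1 edges) and F(T) = n + Σ φ(e_v) with
-- φ(e) = (1 + e)³ − 1. Since φ is convex with φ(0) = 0, moving weight from one entry to a larger one never
-- decreases Σ φ, so Σ φ(e_v) is at most the value on the greedy sequence (m, …, m, j mod m) with ⌊j/m⌋
-- entries m. A caterpillar whose spine vertices have degree Δ realises this sequence, so a maximal tree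
-- attains exactly n + ⌊j/m⌋ φ(m) + φ(j mod m); (i) and (ii) are this number written out.

module Submission where

open import Defs renaming (sym to adj-sym)
open import Data.Nat using (ℕ; _≤_; _∸_; _+_; _*_; _^_)
open import Data.Nat.Divisibility using (_∣_)
open import Data.Integer as ℤ using (ℤ; +_)
open import Data.Integer.Divisibility as ℤd using ()
open import Data.Product using (Σ; _×_)
open import Relation.Nullary using (¬_)
open import Relation.Binary.PropositionalEquality using (_≡_)

open import Data.Nat.Properties
open import Algebra.Properties.CommutativeSemigroup +-commutativeSemigroup using (x∙yz≈y∙xz; x∙yz≈xz∙y; x∙yz≈yx∙z; xy∙z≈xz∙y; xy∙z≈y∙xz)
open import Algebra.Properties.Semiring.Sum +-*-semiring using (sum; sum-cong-≗; ∑-distrib-+; *-distribˡ-sum; sum-replicate-zero)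
open import Data.Bool using (Bool; true; false; _∧_; _∨_; not; T)
open import Data.Bool.Properties using (∧-identityʳ; ∨-comm; ∨-identityʳ) renaming (_≟_ to _≟ᵇ_)
open import Data.Empty using (⊥-elim)
open import Data.Fin using (Fin; zero; suc; toℕ; fromℕ<)
open import Data.Fin.Properties using (any?; toℕ<n; toℕ-injective; toℕ-fromℕ<; injective⇒≤) renaming (_≟_ to _≟ᶠ_)
import Data.Integer.Divisibility.Signed as ℤs
import Data.Integer.Properties as ℤP
import Data.Integer.Tactic.RingSolver as ℤ-Solver
open import Data.List using (List; []; _∷_; _++_; length; lookup; filterᵇ; map; allFin; tabulate)
open import Data.List.Membership.Propositional using (_∈_; _∉_)
open import Data.List.Membership.Propositional.Properties using (∈-lookup)
open import Data.List.Properties using (map-tabulate)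
open import Data.List.Relation.Unary.All as All using (All; []; _∷_)
open import Data.List.Relation.Unary.All.Properties using (++⁻ˡ; ¬Any⇒All¬; All¬⇒¬Any)
open import Data.List.Relation.Unary.AllPairs using ([]; _∷_)
open import Data.List.Relation.Unary.Any using (here; there)
open import Data.List.Relation.Unary.Unique.Propositional using (Unique)
open import Data.Nat using (zero; suc; _<_; _≤′_; ≤′-refl; ≤′-step; z≤n; s≤s; NonZero; >-nonZero⁻¹; _<?_; ∣_-_∣)
open import Data.Nat.DivMod using (_/_; _%_; m≡m%n+[m/n]*n; m%n<n; m%n≤m; m/n*n≤m; m/n*n≡m; m*n/n≡m; 0/n≡0; m<n⇒m/n≡0; m<n⇒m%n≡m; +-distrib-/-∣ˡ; %-remove-+ˡ)
open import Data.Nat.Divisibility using (>⇒∤; n∣m*n; m%n≡0⇒n∣m; n∣m⇒m%n≡0)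
import Data.Nat.ListAction as ListAction
open import Data.Nat.Tactic.RingSolver using (solve-∀)
open import Data.Product using (∃; ∃₂; _,_; proj₁; proj₂)
open import Data.Sum using (_⊎_; inj₁; inj₂)
open import Data.Unit using (tt)
open import Function using (_∘_; id)
open import Relation.Nullary using (yes; no; does; ¬?; _×-dec_)
open import Relation.Nullary.Decidable using (dec-true; dec-false)
open import Relation.Binary.PropositionalEquality

indicator : Bool → ℕ
indicator true  = 1
indicator false = 0

sum-allFin : ∀ {n} (f : Fin n → ℕ) → ListAction.sum (map f (allFin n)) ≡ sum f
sum-allFin {n} f = trans (cong ListAction.sum (map-tabulate id f)) (go f)
  where
    go : ∀ {n} (f : Fin n → ℕ) → ListAction.sum (tabulate f) ≡ sum f
    go {zero}  f = refl
    go {suc n} f = cong (λ t → f zero + t) (go (f ∘ suc))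

sum-mono-≤ : ∀ {n} {f g : Fin n → ℕ} → (∀ i → f i ≤ g i) → sum f ≤ sum g
sum-mono-≤ {zero}  f≤g = z≤n
sum-mono-≤ {suc n} f≤g = +-mono-≤ (f≤g zero) (sum-mono-≤ (f≤g ∘ suc))

term≤sum : ∀ {n} (f : Fin n → ℕ) i → f i ≤ sum f
term≤sum f zero    = m≤m+n _ _
term≤sum f (suc i) = ≤-trans (term≤sum (f ∘ suc) i) (m≤n+m _ _)

sum≢0⇒term≢0 : ∀ {n} (f : Fin n → ℕ) → sum f ≢ 0 → ∃ λ i → f i ≢ 0
sum≢0⇒term≢0 {zero}  f sum≢0 = ⊥-elim (sum≢0 refl)
sum≢0⇒term≢0 {suc n} f sum≢0 with f zero in eq
... | suc _ = zero , λ f0≡0 → 0≢1+n (trans (sym f0≡0) eq)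
... | zero with i , fi≢0 ← sum≢0⇒term≢0 (f ∘ suc) sum≢0 = suc i , fi≢0

∑-distrib-+₃ : ∀ {n} (f g h : Fin n → ℕ) → sum (λ i → f i + g i + h i) ≡ sum f + sum g + sum h
∑-distrib-+₃ f g h = trans (∑-distrib-+ (λ i → f i + g i) h) (cong (_+ sum h) (∑-distrib-+ f g))

sum-const-1 : ∀ n → sum {n} (λ _ → 1) ≡ n
sum-const-1 zero    = refl
sum-const-1 (suc n) = cong suc (sum-const-1 n)

sum-indicator-≟ : ∀ {n} (l : Fin n) c → sum (λ i → indicator (does (l ≟ᶠ i)) * c) ≡ c
sum-indicator-≟ {suc n} zero c =
  trans (cong (λ t → c + 0 + t) (sum-replicate-zero n)) (trans (+-identityʳ _) (+-identityʳ c))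
sum-indicator-≟ {suc n} (suc l) c = sum-indicator-≟ l c

indicator-≟-refl : ∀ p → indicator (does (p ≟ p)) ≡ 1
indicator-≟-refl p = cong indicator (dec-true (p ≟ p) refl)

indicator-≟-≢ : ∀ {p q} → p ≢ q → indicator (does (p ≟ q)) ≡ 0
indicator-≟-≢ {p} {q} p≢q = cong indicator (dec-false (p ≟ q) p≢q)

indicator≢0 : ∀ {b} → indicator b ≢ 0 → b ≡ true
indicator≢0 {true}  _ = refl
indicator≢0 {false} ≢0 = ⊥-elim (≢0 refl)

length-filterᵇ : ∀ {A : Set} (p : A → Bool) xs → length (filterᵇ p xs) ≡ ListAction.sum (map (indicator ∘ p) xs)
length-filterᵇ p []       = refl
length-filterᵇ p (x ∷ xs) with p x
... | true  = cong suc (length-filterᵇ p xs)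
... | false = length-filterᵇ p xs

degree≡sum : ∀ {n} (G : Graph n) v → degree G v ≡ sum (λ u → indicator (adj G v u))
degree≡sum {n} G v = trans (length-filterᵇ (adj G v) (allFin n)) (sum-allFin (λ u → indicator (adj G v u)))

-- Forests have at most n − 1 edges

Unique-++⁻ˡ : ∀ {A : Set} (xs : List A) {ys} → Unique (xs ++ ys) → Unique xs
Unique-++⁻ˡ []       _        = []
Unique-++⁻ˡ (x ∷ xs) (x∉ ∷ u) = ++⁻ˡ xs x∉ ∷ Unique-++⁻ˡ xs u

lookup-injective : ∀ {A : Set} {xs : List A} → Unique xs → ∀ {i j} → lookup xs i ≡ lookup xs j → i ≡ j
lookup-injective {xs = x ∷ xs} (x∉ ∷ u) {zero}  {zero}  _  = refl
lookup-injective {xs = x ∷ xs} (x∉ ∷ u) {zero}  {suc j} eq = ⊥-elim (All.lookup x∉ (∈-lookup j) eq)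
lookup-injective {xs = x ∷ xs} (x∉ ∷ u) {suc i} {zero}  eq = ⊥-elim (All.lookup x∉ (∈-lookup i) (sym eq))
lookup-injective {xs = x ∷ xs} (x∉ ∷ u) {suc i} {suc j} eq = cong suc (lookup-injective u eq)

Unique⇒length≤ : ∀ {n} {xs : List (Fin n)} → Unique xs → length xs ≤ n
Unique⇒length≤ u = injective⇒≤ (lookup-injective u)

path-prefix : ∀ {n} {G : Graph n} {a vs l y} → IsPathFrom G a vs l → y ∈ vs →
  ∃₂ λ y₀ ys → ∃ λ zs → vs ≡ (y₀ ∷ ys) ++ zs × IsPathFrom G a (y₀ ∷ ys) y
path-prefix (cons {w = w} {vs = vs} a~w _) (here refl) = w , [] , vs , refl , cons a~w end
path-prefix (cons {w = w} a~w p) (there y∈vs) with path-prefix p y∈vs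
... | y₀ , ys , zs , refl , q = w , y₀ ∷ ys , zs , refl , cons a~w q

module Forest {n} (G : Graph n) where

  open import Data.List.Membership.DecPropositional (_≟ᶠ_ {n}) using (_∈?_)

  -- A vertex set s : Fin n → Bool induces a subgraph; `degreeSumIn s` counts each of its edges twice.
  edgeIn : (Fin n → Bool) → Fin n → Fin n → Bool
  edgeIn s v u = s v ∧ s u ∧ adj G v u

  degreeIn : (Fin n → Bool) → Fin n → ℕ
  degreeIn s v = sum (indicator ∘ edgeIn s v)

  degreeSumIn : (Fin n → Bool) → ℕ
  degreeSumIn s = sum (degreeIn s)

  size : (Fin n → Bool) → ℕ
  size s = sum (indicator ∘ s)

  delete : (Fin n → Bool) → Fin n → Fin n → Bool
  delete s l v = s v ∧ not (does (l ≟ᶠ v))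

  edgeIn-sym : ∀ s v u → edgeIn s v u ≡ edgeIn s u v
  edgeIn-sym s v u rewrite adj-sym G v u with s v | s u
  ... | true  | true  = refl
  ... | true  | false = refl
  ... | false | true  = refl
  ... | false | false = refl

  edgeIn-delete : ∀ s l v u → indicator (edgeIn s v u) ≡
    indicator (edgeIn (delete s l) v u) + indicator (does (l ≟ᶠ v)) * indicator (edgeIn s l u)
                                        + indicator (does (l ≟ᶠ u)) * indicator (edgeIn s v l)
  edgeIn-delete s l v u with l ≟ᶠ v | l ≟ᶠ u
  ... | yes refl | yes refl rewrite irrefl G l with s l
  ...   | true  = refl
  ...   | false = refl
  edgeIn-delete s l v u | yes refl | no _ with s l
  ...   | true  = sym (trans (+-identityʳ _) (+-identityʳ _))
  ...   | false = refl
  edgeIn-delete s l v u | no _ | yes refl with s v | s l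
  ...   | true  | true  = sym (+-identityʳ _)
  ...   | true  | false = refl
  ...   | false | _     = refl
  edgeIn-delete s l v u | no _ | no _ rewrite ∧-identityʳ (s v) | ∧-identityʳ (s u) =
    sym (trans (+-identityʳ _) (+-identityʳ _))

  degreeSumIn-delete : ∀ s l → degreeSumIn s ≡ degreeSumIn (delete s l) + degreeIn s l + degreeIn s l
  degreeSumIn-delete s l = begin
    degreeSumIn s
      ≡⟨ sum-cong-≗ (λ v → trans (sum-cong-≗ (edgeIn-delete s l v)) (∑-distrib-+₃ (kept v) (fromL v) (toL v))) ⟩
    sum (λ v → sum (kept v) + sum (fromL v) + sum (toL v))
      ≡⟨ ∑-distrib-+₃ (λ v → sum (kept v)) (λ v → sum (fromL v)) (λ v → sum (toL v)) ⟩
    degreeSumIn (delete s l) + sum (λ v → sum (fromL v)) + sum (λ v → sum (toL v))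
      ≡⟨ cong₂ (λ a b → degreeSumIn (delete s l) + a + b) fromL-total toL-total ⟩
    degreeSumIn (delete s l) + degreeIn s l + degreeIn s l ∎
    where
      open ≡-Reasoning
      kept fromL toL : Fin n → Fin n → ℕ
      kept  v u = indicator (edgeIn (delete s l) v u)
      fromL v u = indicator (does (l ≟ᶠ v)) * indicator (edgeIn s l u)
      toL   v u = indicator (does (l ≟ᶠ u)) * indicator (edgeIn s v l)
      fromL-total : sum (λ v → sum (fromL v)) ≡ degreeIn s l
      fromL-total = trans (sum-cong-≗ (λ v → sym (*-distribˡ-sum {n} (indicator (does (l ≟ᶠ v))) (indicator ∘ edgeIn s l))))
                          (sum-indicator-≟ l (degreeIn s l))
      toL-total : sum (λ v → sum (toL v)) ≡ degreeIn s l
      toL-total = sum-cong-≗ (λ v → trans (sum-indicator-≟ l _) (cong indicator (edgeIn-sym s v l)))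

  size-delete : ∀ s l → s l ≡ true → size s ≡ size (delete s l) + 1
  size-delete s l l∈s = begin
    size s
      ≡⟨ sum-cong-≗ split ⟩
    sum (λ v → indicator (delete s l v) + indicator (does (l ≟ᶠ v)) * 1)
      ≡⟨ ∑-distrib-+ (indicator ∘ delete s l) (λ v → indicator (does (l ≟ᶠ v)) * 1) ⟩
    size (delete s l) + sum (λ v → indicator (does (l ≟ᶠ v)) * 1)
      ≡⟨ cong (λ t → size (delete s l) + t) (sum-indicator-≟ l 1) ⟩
    size (delete s l) + 1 ∎
    where
      open ≡-Reasoning
      split : ∀ v → indicator (s v) ≡ indicator (delete s l v) + indicator (does (l ≟ᶠ v)) * 1
      split v with l ≟ᶠ v
      ... | yes refl rewrite l∈s = refl
      ... | no _ rewrite ∧-identityʳ (s v) = sym (+-identityʳ _)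

  Adj-irrefl : ∀ {v} → ¬ Adj G v v
  Adj-irrefl {v} v~v with () ← trans (sym v~v) (irrefl G v)

  edgeIn-true : ∀ s {v u} → edgeIn s v u ≡ true → s v ≡ true × s u ≡ true × Adj G v u
  edgeIn-true s {v} {u} e with s v | s u
  ... | true | true = refl , refl , e

  record Leaf (s : Fin n → Bool) (l w : Fin n) : Set where
    field
      l∈s : s l ≡ true
      w∈s : s w ≡ true
      w≢l : w ≢ l
      unique-neighbour : ∀ u → edgeIn s l u ≡ true → u ≡ w

  degreeIn-leaf : ∀ {s l w} → Leaf s l w → degreeIn s l ≤ 1
  degreeIn-leaf {s} {l} {w} leaf = ≤-trans (sum-mono-≤ at-w) (≤-reflexive (sum-indicator-≟ w 1))
    where
      at-w : ∀ u → indicator (edgeIn s l u) ≤ indicator (does (w ≟ᶠ u)) * 1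
      at-w u with edgeIn s l u in e
      ... | false = z≤n
      ... | true with refl ← Leaf.unique-neighbour leaf u e | w ≟ᶠ w
      ...   | yes _ = ≤-refl
      ...   | no w≢w = ⊥-elim (w≢w refl)

  delete-leaf-bound : ∀ {s l w} → Leaf s l w →
    degreeSumIn (delete s l) ≤ 2 * (size (delete s l) ∸ 1) → degreeSumIn s ≤ 2 * (size s ∸ 1)
  delete-leaf-bound {s} {l} {w} leaf ih = begin
    degreeSumIn s                                          ≡⟨ degreeSumIn-delete s l ⟩
    degreeSumIn (delete s l) + degreeIn s l + degreeIn s l ≤⟨ +-mono-≤ (+-mono-≤ ih (degreeIn-leaf leaf)) (degreeIn-leaf leaf) ⟩
    2 * (size (delete s l) ∸ 1) + 1 + 1                    ≡⟨ double-pred (size (delete s l)) size-delete≥1 ⟩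
    2 * size (delete s l)                                  ≡⟨ cong (λ k → 2 * k) (sym (m+n∸n≡m (size (delete s l)) 1)) ⟩
    2 * (size (delete s l) + 1 ∸ 1)                        ≡⟨ cong (λ k → 2 * (k ∸ 1)) (sym (size-delete s l (Leaf.l∈s leaf))) ⟩
    2 * (size s ∸ 1)                                       ∎
    where
      open ≤-Reasoning
      double-pred : ∀ a → 1 ≤ a → 2 * (a ∸ 1) + 1 + 1 ≡ 2 * a
      double-pred (suc a) _ = trans (+-assoc (2 * a) 1 1) (trans (+-comm (2 * a) 2) (sym (*-suc 2 a)))
      w-kept : delete s l w ≡ true
      w-kept with l ≟ᶠ w
      ... | yes refl = ⊥-elim (Leaf.w≢l leaf refl)
      ... | no _ = trans (∧-identityʳ (s w)) (Leaf.w∈s leaf)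
      size-delete≥1 : 1 ≤ size (delete s l)
      size-delete≥1 = subst (λ b → indicator b ≤ size (delete s l)) w-kept (term≤sum (indicator ∘ delete s l) w)

  back-edge-cycle : ∀ {e w rest l u} → IsPathFrom G e (w ∷ rest) l → Unique (e ∷ w ∷ rest) →
                    u ∈ rest → Adj G u e → Cycle G
  back-edge-cycle {e} {w} (cons e~w p) distinct u∈rest u~e with path-prefix p u∈rest
  ... | x , ys , zs , refl , q = record
    { path = cons e~w q ; distinct = Unique-++⁻ˡ (e ∷ w ∷ x ∷ ys) distinct ; closing = u~e }

  record PathIn (s : Fin n → Bool) : Set where
    field
      start next last : Fin n
      rest : List (Fin n)
      walk : IsPathFrom G start (next ∷ rest) last
      distinct : Unique (start ∷ next ∷ rest)
      inside : All (λ v → s v ≡ true) (start ∷ next ∷ rest)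

    vertices : List (Fin n)
    vertices = start ∷ next ∷ rest

  open PathIn

  extend : ∀ {s} (p : PathIn s) u → edgeIn s (start p) u ≡ true → u ∉ vertices p → PathIn s
  extend {s} p u e u∉p with edgeIn-true s e
  ... | _ , u∈s , start~u = record
    { start = u ; next = start p ; last = last p ; rest = next p ∷ rest p
    ; walk = cons (trans (adj-sym G u (start p)) start~u) (walk p)
    ; distinct = ¬Any⇒All¬ _ u∉p ∷ distinct p
    ; inside = u∈s ∷ inside p }

  module _ (acyclic : Acyclic G) where

    stuck-start-is-leaf : ∀ {s} (p : PathIn s) →
      ¬ (∃ λ u → edgeIn s (start p) u ≡ true × u ∉ vertices p) → Leaf s (start p) (next p)
    stuck-start-is-leaf {s} p stuck = record
      { l∈s = start∈s ; w∈s = next∈s ; w≢l = λ eq → start∉ (here (sym eq)) ; unique-neighbour = only-next }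
      where
        start∈s : s (start p) ≡ true
        start∈s with inside p
        ... | i ∷ _ = i
        next∈s : s (next p) ≡ true
        next∈s with inside p
        ... | _ ∷ i ∷ _ = i
        start∉ : start p ∉ next p ∷ rest p
        start∉ with distinct p
        ... | d ∷ _ = λ m → All.lookup d m refl
        only-next : ∀ u → edgeIn s (start p) u ≡ true → u ≡ next p
        only-next u e with u ∈? vertices p
        ... | no u∉p = ⊥-elim (stuck (u , e , u∉p))
        ... | yes (here u≡start) = ⊥-elim (Adj-irrefl (subst (Adj G (start p)) u≡start (proj₂ (proj₂ (edgeIn-true s e)))))
        ... | yes (there (here u≡next)) = u≡next
        ... | yes (there (there u∈rest)) =
          ⊥-elim (acyclic (back-edge-cycle (walk p) (distinct p) u∈rest
                           (trans (adj-sym G u (start p)) (proj₂ (proj₂ (edgeIn-true s e))))))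

    -- A path that cannot be extended at its start begins at a leaf; `fuel` bounds the number of
    -- extensions, since the vertices of a path are distinct.
    leaf-from-path : ∀ {s} fuel (p : PathIn s) → n < length (vertices p) + fuel → ∃₂ (Leaf s)
    leaf-from-path zero p n<len = ⊥-elim (<⇒≱ (subst (n <_) (+-identityʳ _) n<len) (Unique⇒length≤ (distinct p)))
    leaf-from-path {s} (suc fuel) p n<len
      with any? (λ u → (edgeIn s (start p) u ≟ᵇ true) ×-dec ¬? (u ∈? vertices p))
    ... | no stuck = start p , next p , stuck-start-is-leaf p stuck
    ... | yes (u , e , u∉p) = leaf-from-path fuel (extend p u e u∉p) (subst (n <_) (+-suc _ fuel) n<len)

    leaf-exists : ∀ {s v u} → edgeIn s v u ≡ true → ∃₂ (Leaf s)
    leaf-exists {s} {v} {u} e with edgeIn-true s e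
    ... | v∈s , u∈s , v~u = leaf-from-path n path (m<n⇒m<1+n (n<1+n n))
      where
        path : PathIn s
        path = record
          { start = u ; next = v ; last = v ; rest = []
          ; walk = cons (trans (adj-sym G u v) v~u) end
          ; distinct = ((λ { refl → Adj-irrefl v~u }) ∷ []) ∷ [] ∷ []
          ; inside = u∈s ∷ v∈s ∷ [] }

    edgeless-or-leaf : ∀ s → degreeSumIn s ≡ 0 ⊎ ∃₂ (Leaf s)
    edgeless-or-leaf s with degreeSumIn s ≟ 0
    ... | yes ≡0 = inj₁ ≡0
    ... | no ≢0
      with v , degree≢0 ← sum≢0⇒term≢0 (degreeIn s) ≢0
      with u , edge≢0   ← sum≢0⇒term≢0 (indicator ∘ edgeIn s v) degree≢0 =
      inj₂ (leaf-exists (indicator≢0 edge≢0))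

    degreeSumIn-acyclic : ∀ k s → size s ≤ k → degreeSumIn s ≤ 2 * (size s ∸ 1)
    degreeSumIn-acyclic k s size≤k with edgeless-or-leaf s
    ... | inj₁ ≡0 = ≤-trans (≤-reflexive ≡0) z≤n
    degreeSumIn-acyclic zero    s size≤0 | inj₂ (l , _ , leaf) =
      ⊥-elim (1+n≰n (≤-trans (subst (λ b → indicator b ≤ size s) (Leaf.l∈s leaf) (term≤sum (indicator ∘ s) l)) size≤0))
    degreeSumIn-acyclic (suc k) s size≤k | inj₂ (l , _ , leaf) =
      delete-leaf-bound leaf (degreeSumIn-acyclic k (delete s l)
        (≤-pred (subst (_≤ suc k) (trans (size-delete s l (Leaf.l∈s leaf)) (+-comm _ 1)) size≤k)))

  sum-degree≤2[n∸1] : Acyclic G → sum (degree G) ≤ 2 * (n ∸ 1)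
  sum-degree≤2[n∸1] acyclic = begin
    sum (degree G)               ≡⟨ sum-cong-≗ (degree≡sum G) ⟩
    degreeSumIn (λ _ → true)     ≤⟨ degreeSumIn-acyclic acyclic n (λ _ → true) (≤-reflexive (sum-const-1 n)) ⟩
    2 * (size (λ _ → true) ∸ 1)  ≡⟨ cong (λ k → 2 * (k ∸ 1)) (sum-const-1 n) ⟩
    2 * (n ∸ 1)                  ∎
    where open ≤-Reasoning

-- Majorisation by the greedy sequence

Convex : (ℕ → ℕ) → Set
Convex φ = ∀ k u v → φ (k + u) + φ (k + v) ≤ φ k + φ (k + u + v)

quotient-remainder-unique : ∀ q r m .{{_ : NonZero m}} → r < m → (q * m + r) / m ≡ q × (q * m + r) % m ≡ r
quotient-remainder-unique q r m r<m =
  trans (trans (+-distrib-/-∣ˡ r (n∣m*n q)) (cong₂ _+_ (m*n/n≡m q m) (m<n⇒m/n≡0 r<m))) (+-identityʳ q) ,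
  trans (%-remove-+ˡ r (n∣m*n q)) (m<n⇒m%n≡m r<m)

decompose : ∀ s m .{{_ : NonZero m}} → s ≡ s / m * m + s % m
decompose s m = trans (m≡m%n+[m/n]*n s m) (+-comm (s % m) _)

suc-quotient-remainder : ∀ s m .{{_ : NonZero m}} →
  (suc (s % m) < m × suc s / m ≡ s / m × suc s % m ≡ suc (s % m)) ⊎
  (suc (s % m) ≡ m × suc s / m ≡ suc (s / m) × suc s % m ≡ 0)
suc-quotient-remainder s m with suc (s % m) <? m
... | yes r+1<m = inj₁ (r+1<m , subst (λ t → t / m ≡ s / m × t % m ≡ suc (s % m)) (sym suc-s≡)
                                      (quotient-remainder-unique (s / m) (suc (s % m)) m r+1<m))
  where
    suc-s≡ : suc s ≡ s / m * m + suc (s % m)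
    suc-s≡ = trans (cong suc (decompose s m)) (sym (+-suc _ _))
... | no r+1≮m = inj₂ (r+1≡m , subst (λ t → t / m ≡ suc (s / m) × t % m ≡ 0) (sym suc-s≡)
                                     (quotient-remainder-unique (suc (s / m)) 0 m (>-nonZero⁻¹ m)))
  where
    r+1≡m : suc (s % m) ≡ m
    r+1≡m = ≤-antisym (m%n<n s m) (≮⇒≥ r+1≮m)
    suc-s≡ : suc s ≡ suc (s / m) * m + 0
    suc-s≡ = begin
      suc s                         ≡⟨ cong suc (decompose s m) ⟩
      suc (s / m * m + s % m)       ≡⟨ sym (+-suc _ _) ⟩
      s / m * m + suc (s % m)       ≡⟨ cong (λ t → s / m * m + t) r+1≡m ⟩
      s / m * m + m                 ≡⟨ +-comm _ m ⟩
      suc (s / m) * m               ≡⟨ sym (+-identityʳ _) ⟩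
      suc (s / m) * m + 0           ∎
      where open ≡-Reasoning

module Majorisation (φ : ℕ → ℕ) (convex : Convex φ) (φ0≡0 : φ 0 ≡ 0) (m : ℕ) .{{_ : NonZero m}} where

  superadditive : ∀ u v → φ u + φ v ≤ φ (u + v)
  superadditive u v = subst (λ z → φ u + φ v ≤ z + φ (u + v)) φ0≡0 (convex 0 u v)

  exchange-below : ∀ {a b c} → c ≤ a → c ≤ b → a + b ≡ m + c → φ a + φ b ≤ φ m + φ c
  exchange-below {c = c} c≤a c≤b a+b≡m+c
    with u , refl ← m≤n⇒∃[o]m+o≡n c≤a | v , refl ← m≤n⇒∃[o]m+o≡n c≤b =
    subst (λ z → φ (c + u) + φ (c + v) ≤ φ z + φ c) (sym m≡c+u+v)
          (subst (φ (c + u) + φ (c + v) ≤_) (+-comm (φ c) _) (convex c u v))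
    where
      m≡c+u+v : m ≡ c + u + v
      m≡c+u+v = +-cancelʳ-≡ c m (c + u + v) (trans (sym a+b≡m+c) (x∙yz≈xz∙y (c + u) c v))

  exchange : ∀ {a b c} → a ≤ m → b ≤ m → a + b ≡ m + c → φ a + φ b ≤ φ m + φ c
  exchange {a} {b} {c} a≤m b≤m a+b≡m+c = exchange-below c≤a c≤b a+b≡m+c
    where
      c≤a : c ≤ a
      c≤a = +-cancelʳ-≤ m c a (subst (_≤ a + m) (trans a+b≡m+c (+-comm m c)) (+-monoʳ-≤ a b≤m))
      c≤b : c ≤ b
      c≤b = +-cancelˡ-≤ m c b (subst (_≤ m + b) a+b≡m+c (+-monoˡ-≤ b a≤m))

  -- Σ φ over the sequence (m, …, m, s % m) with s / m entries m.
  greedy : ℕ → ℕ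
  greedy s = s / m * φ m + φ (s % m)

  greedy-≡ : ∀ q {r} → r < m → greedy (q * m + r) ≡ q * φ m + φ r
  greedy-≡ q {r} r<m with q≡ , r≡ ← quotient-remainder-unique q r m r<m = cong₂ (λ a b → a * φ m + φ b) q≡ r≡

  φ+greedy≤greedy-repr : ∀ {a} q r → r < m → a ≤ m → φ a + (q * φ m + φ r) ≤ greedy (a + (q * m + r))
  φ+greedy≤greedy-repr {a} q r r<m a≤m with a + r <? m
  ... | yes a+r<m = begin
    φ a + (q * φ m + φ r)   ≡⟨ x∙yz≈y∙xz (φ a) (q * φ m) (φ r) ⟩
    q * φ m + (φ a + φ r)   ≤⟨ +-monoʳ-≤ (q * φ m) (superadditive a r) ⟩
    q * φ m + φ (a + r)     ≡⟨ sym (greedy-≡ q a+r<m) ⟩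
    greedy (q * m + (a + r)) ≡⟨ cong greedy (x∙yz≈y∙xz (q * m) a r) ⟩
    greedy (a + (q * m + r)) ∎
    where open ≤-Reasoning
  ... | no a+r≮m = begin
    φ a + (q * φ m + φ r)     ≡⟨ x∙yz≈y∙xz (φ a) (q * φ m) (φ r) ⟩
    q * φ m + (φ a + φ r)     ≤⟨ +-monoʳ-≤ (q * φ m) (exchange a≤m (<⇒≤ r<m) a+r≡m+c) ⟩
    q * φ m + (φ m + φ c)     ≡⟨ x∙yz≈yx∙z (q * φ m) (φ m) (φ c) ⟩
    suc q * φ m + φ c         ≡⟨ sym (greedy-≡ (suc q) c<m) ⟩
    greedy (suc q * m + c)     ≡⟨ cong greedy (trans (xy∙z≈y∙xz m (q * m) c) (cong (λ t → q * m + t) (sym a+r≡m+c))) ⟩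
    greedy (q * m + (a + r))   ≡⟨ cong greedy (x∙yz≈y∙xz (q * m) a r) ⟩
    greedy (a + (q * m + r))   ∎
    where
      open ≤-Reasoning
      c : ℕ
      c = a + r ∸ m
      a+r≡m+c : a + r ≡ m + c
      a+r≡m+c = sym (m+[n∸m]≡n (≮⇒≥ a+r≮m))
      c<m : c < m
      c<m = +-cancelˡ-< m c m (subst (_< m + m) a+r≡m+c (+-mono-≤-< a≤m r<m))

  φ+greedy≤greedy : ∀ {a} s → a ≤ m → φ a + greedy s ≤ greedy (a + s)
  φ+greedy≤greedy {a} s a≤m =
    subst (λ u → φ a + greedy s ≤ greedy (a + u)) (sym (decompose s m))
      (φ+greedy≤greedy-repr (s / m) (s % m) (m%n<n s m) a≤m)

  greedy≤greedy-suc : ∀ t → greedy t ≤ greedy (suc t)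
  greedy≤greedy-suc t = ≤-trans (m≤n+m (greedy t) (φ 1)) (φ+greedy≤greedy t (>-nonZero⁻¹ m))

  greedy-mono : ∀ {s t} → s ≤ t → greedy s ≤ greedy t
  greedy-mono s≤t = go (≤⇒≤′ s≤t)
    where
      go : ∀ {s t} → s ≤′ t → greedy s ≤ greedy t
      go ≤′-refl            = ≤-refl
      go (≤′-step {t} s≤′t) = ≤-trans (go s≤′t) (greedy≤greedy-suc t)

  sum-φ≤greedy : ∀ {n} (e : Fin n → ℕ) → (∀ i → e i ≤ m) → sum (φ ∘ e) ≤ greedy (sum e)
  sum-φ≤greedy {zero}  e e≤m = z≤n
  sum-φ≤greedy {suc n} e e≤m = begin
    φ (e zero) + sum (φ ∘ e ∘ suc)      ≤⟨ +-monoʳ-≤ (φ (e zero)) (sum-φ≤greedy (e ∘ suc) (e≤m ∘ suc)) ⟩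
    φ (e zero) + greedy (sum (e ∘ suc)) ≤⟨ φ+greedy≤greedy (sum (e ∘ suc)) (e≤m zero) ⟩
    greedy (sum e)                      ∎
    where open ≤-Reasoning

  greedy-suc : ∀ s → greedy (suc s) + φ (s % m) ≡ greedy s + φ (suc (s % m))
  greedy-suc s with suc-quotient-remainder s m
  ... | inj₁ (_ , q≡ , r≡) rewrite q≡ | r≡ = xy∙z≈xz∙y (s / m * φ m) (φ (suc (s % m))) (φ (s % m))
  ... | inj₂ (r+1≡m , q≡ , r≡) rewrite q≡ | r≡ | φ0≡0 | r+1≡m = begin
    φ m + s / m * φ m + 0 + φ (s % m) ≡⟨ cong (_+ φ (s % m)) (+-identityʳ _) ⟩
    φ m + s / m * φ m + φ (s % m)     ≡⟨ cong (_+ φ (s % m)) (+-comm (φ m) _) ⟩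
    s / m * φ m + φ m + φ (s % m)     ≡⟨ xy∙z≈xz∙y (s / m * φ m) (φ m) (φ (s % m)) ⟩
    s / m * φ m + φ (s % m) + φ m     ∎
    where open ≡-Reasoning

-- Recursive trees

walk-++ : ∀ {n} {G : Graph n} {u v w} → Walk G u v → Walk G v w → Walk G u w
walk-++ here         q = q
walk-++ (step u~x p) q = step u~x (walk-++ p q)

walk-reverse : ∀ {n} {G : Graph n} {u v} → Walk G u v → Walk G v u
walk-reverse {G = G} here = here
walk-reverse {G = G} (step {u} {x} u~x p) = walk-++ (walk-reverse p) (step (trans (adj-sym G x u) u~x) here)

sumBelow : (ℕ → ℕ) → ℕ → ℕ
sumBelow f zero    = 0
sumBelow f (suc N) = sumBelow f N + f N

sumBelow-cong : ∀ {f g} N → (∀ i → i < N → f i ≡ g i) → sumBelow f N ≡ sumBelow g N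
sumBelow-cong zero    f≡g = refl
sumBelow-cong (suc N) f≡g = cong₂ _+_ (sumBelow-cong N (λ i i<N → f≡g i (m<n⇒m<1+n i<N))) (f≡g N (n<1+n N))

sumBelow-suc : ∀ f N → sumBelow f (suc N) ≡ f 0 + sumBelow (f ∘ suc) N
sumBelow-suc f zero    = +-comm 0 (f 0)
sumBelow-suc f (suc N) = trans (cong (_+ f (suc N)) (sumBelow-suc f N)) (+-assoc (f 0) _ _)

sum-toℕ : ∀ n (f : ℕ → ℕ) → sum {n} (f ∘ toℕ) ≡ sumBelow f n
sum-toℕ zero    f = refl
sum-toℕ (suc n) f = trans (cong (λ t → f 0 + t) (sum-toℕ n (f ∘ suc))) (sym (sumBelow-suc f n))

sumBelow-≡0 : ∀ {f} N → (∀ i → i < N → f i ≡ 0) → sumBelow f N ≡ 0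
sumBelow-≡0 zero    f≡0 = refl
sumBelow-≡0 (suc N) f≡0 =
  cong₂ _+_ (sumBelow-≡0 N (λ i i<N → f≡0 i (m<n⇒m<1+n i<N))) (f≡0 N (n<1+n N))

sumBelow-indicator : ∀ {p} N → p < N → sumBelow (λ i → indicator (does (p ≟ i))) N ≡ 1
sumBelow-indicator {p} (suc N) p<1+N with p ≟ N
... | yes refl = cong₂ _+_ (sumBelow-≡0 N (λ i i<p → indicator-≟-≢ (>⇒≢ i<p))) (indicator-≟-refl p)
... | no p≢N   = cong₂ _+_ (sumBelow-indicator N (≤∧≢⇒< (≤-pred p<1+N) p≢N)) (indicator-≟-≢ p≢N)

sumBelow-increment : ∀ (h g : ℕ → ℕ) {p} N → p < N →
  sumBelow (λ v → h (g v + indicator (does (p ≟ v)))) N + h (g p) ≡ sumBelow (h ∘ g) N + h (suc (g p))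
sumBelow-increment h g {p} (suc N) p<1+N with p ≟ N
... | yes refl = begin
  sumBelow bumped p + h (g p + indicator (does (p ≟ p))) + h (g p)
    ≡⟨ cong₂ (λ x i → x + h (g p + i) + h (g p)) (sumBelow-cong p unbumped) (indicator-≟-refl p) ⟩
  sumBelow (h ∘ g) p + h (g p + 1) + h (g p) ≡⟨ xy∙z≈xz∙y (sumBelow (h ∘ g) p) _ _ ⟩
  sumBelow (h ∘ g) p + h (g p) + h (g p + 1) ≡⟨ cong (λ x → sumBelow (h ∘ g) p + h (g p) + h x) (+-comm (g p) 1) ⟩
  sumBelow (h ∘ g) p + h (g p) + h (suc (g p)) ∎
  where
    open ≡-Reasoning
    bumped : ℕ → ℕ
    bumped v = h (g v + indicator (does (p ≟ v)))
    unbumped : ∀ v → v < p → bumped v ≡ h (g v)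
    unbumped v v<p = cong h (trans (cong (λ i → g v + i) (indicator-≟-≢ (>⇒≢ v<p))) (+-identityʳ (g v)))
... | no p≢N = begin
  sumBelow bumped N + h (g N + indicator (does (p ≟ N))) + h (g p)
    ≡⟨ cong (λ i → sumBelow bumped N + h (g N + i) + h (g p)) (indicator-≟-≢ p≢N) ⟩
  sumBelow bumped N + h (g N + 0) + h (g p)   ≡⟨ cong (λ x → sumBelow bumped N + h x + h (g p)) (+-identityʳ (g N)) ⟩
  sumBelow bumped N + h (g N) + h (g p)       ≡⟨ xy∙z≈xz∙y (sumBelow bumped N) _ _ ⟩
  sumBelow bumped N + h (g p) + h (g N)       ≡⟨ cong (_+ h (g N)) (sumBelow-increment h g N (≤∧≢⇒< (≤-pred p<1+N) p≢N)) ⟩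
  sumBelow (h ∘ g) N + h (suc (g p)) + h (g N) ≡⟨ xy∙z≈xz∙y (sumBelow (h ∘ g) N) _ _ ⟩
  sumBelow (h ∘ g) N + h (g N) + h (suc (g p)) ∎
  where
    open ≡-Reasoning
    bumped : ℕ → ℕ
    bumped v = h (g v + indicator (does (p ≟ v)))

module RecursiveTree (parent : ℕ → ℕ) (parent< : ∀ c → parent (suc c) < suc c) where

  isChildOf : ℕ → ℕ → Bool
  isChildOf zero    p = false
  isChildOf (suc c) p = does (parent (suc c) ≟ p)

  joined : ℕ → ℕ → Bool
  joined u v = isChildOf u v ∨ isChildOf v u

  isChildOf-≤ : ∀ {c p} → c ≤ p → isChildOf c p ≡ false
  isChildOf-≤ {zero}  _   = refl
  isChildOf-≤ {suc c} c≤p = dec-false (parent (suc c) ≟ _) (λ eq → <⇒≱ (parent< c) (subst (suc c ≤_) (sym eq) c≤p))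

  isChildOf-true : ∀ c p → isChildOf c p ≡ true → p < c × parent c ≡ p
  isChildOf-true (suc c) p e = subst (_< suc c) parent≡p (parent< c) , parent≡p
    where parent≡p = ≡ᵇ⇒≡ (parent (suc c)) p (subst T (sym e) tt)

  tree : (n : ℕ) → Graph n
  tree n = record
    { adj    = λ u v → joined (toℕ u) (toℕ v)
    ; sym    = λ u v → ∨-comm (isChildOf (toℕ u) (toℕ v)) _
    ; irrefl = λ v → cong (λ b → b ∨ b) (isChildOf-≤ {toℕ v} ≤-refl) }

  module _ {n : ℕ} where

    record ParentOf (p c : Fin n) : Set where
      constructor parentOf
      field isChild : isChildOf (toℕ c) (toℕ p) ≡ true

    parent-< : ∀ {p c} → ParentOf p c → toℕ p < toℕ c
    parent-< {p} {c} (parentOf p-c) = proj₁ (isChildOf-true (toℕ c) (toℕ p) p-c)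

    parent-unique : ∀ {p p′ c} → ParentOf p c → ParentOf p′ c → p ≡ p′
    parent-unique {p} {p′} {c} (parentOf p-c) (parentOf p′-c) = toℕ-injective (begin
      toℕ p          ≡⟨ sym (proj₂ (isChildOf-true (toℕ c) (toℕ p) p-c)) ⟩
      parent (toℕ c) ≡⟨ proj₂ (isChildOf-true (toℕ c) (toℕ p′) p′-c) ⟩
      toℕ p′         ∎)
      where open ≡-Reasoning

    Adj⇒parent : ∀ {u v} → Adj (tree n) u v → ParentOf v u ⊎ ParentOf u v
    Adj⇒parent {u} {v} u~v with isChildOf (toℕ u) (toℕ v) in e
    ... | true  = inj₁ (parentOf e)
    ... | false = inj₂ (parentOf u~v)

    end-∈ : ∀ {a v vs l} → IsPathFrom (tree n) a (v ∷ vs) l → l ∈ v ∷ vs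
    end-∈ (cons _ end)        = here refl
    end-∈ (cons _ (cons x p)) = there (end-∈ (cons x p))

    -- Having stepped down from p to its child a, a path can only keep stepping down: the one upward
    -- neighbour of a is p. This is what rules out cycles.
    descending : ∀ {p a vs l} → ParentOf p a → IsPathFrom (tree n) a vs l → All (p ≢_) vs → Unique (a ∷ vs) →
                 toℕ a ≤ toℕ l × (l ≡ a ⊎ ∃ λ z → ParentOf z l × z ∈ a ∷ vs)
    descending p-a end _ _ = ≤-refl , inj₁ refl
    descending {a = a} p-a (cons {w = b} a~b path) (p≢b ∷ p∉) ((_ ∷ a∉) ∷ distinct) with Adj⇒parent {a} {b} a~b
    ... | inj₁ b-a = ⊥-elim (p≢b (parent-unique p-a b-a))
    ... | inj₂ a-b with descending a-b path a∉ distinct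
    ...   | b≤l , inj₁ refl = <⇒≤ (parent-< a-b) , inj₂ (a , a-b , here refl)
    ...   | b≤l , inj₂ (z , z-l , z∈) = ≤-trans (<⇒≤ (parent-< a-b)) b≤l , inj₂ (z , z-l , there z∈)

    ascending-then-descending : ∀ {c a vs l} → ParentOf a c → IsPathFrom (tree n) a vs l → Unique (c ∷ a ∷ vs) →
                                toℕ l < toℕ c ⊎ ∃ λ z → ParentOf z l × z ∈ a ∷ vs
    ascending-then-descending a-c end _ = inj₁ (parent-< a-c)
    ascending-then-descending {a = a} a-c (cons {w = b} a~b path) (_ ∷ distinct@((_ ∷ a∉) ∷ _)) with Adj⇒parent {a} {b} a~b
    ... | inj₁ b-a with ascending-then-descending b-a path distinct
    ...   | inj₁ l<a = inj₁ (<-trans l<a (parent-< a-c))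
    ...   | inj₂ (z , z-l , z∈) = inj₂ (z , z-l , there z∈)
    ascending-then-descending {a = a} a-c (cons {w = b} a~b path) (_ ∷ (_ ∷ a∉) ∷ distinct) | inj₂ a-b
      with descending a-b path a∉ distinct
    ... | _ , inj₁ refl = inj₂ (a , a-b , here refl)
    ... | _ , inj₂ (z , z-l , z∈) = inj₂ (z , z-l , there z∈)

    acyclic : Acyclic (tree n)
    acyclic c with Cycle.path c | Cycle.distinct c | Cycle.closing c
    ... | cons {w = w} u~w path | distinct@(u∉@(_ ∷ u∉′) ∷ distinct′@(w∉ ∷ _)) | last~u
      with Adj⇒parent u~w | Adj⇒parent last~u
    ... | inj₂ u-w | closing with descending u-w path u∉′ distinct′
    ...   | _ , inj₁ refl = All¬⇒¬Any w∉ (end-∈ path)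
    ...   | w≤last , inj₂ (z , z-last , z∈) with closing
    ...     | inj₁ u-last = All¬⇒¬Any u∉ (subst (_∈ _) (parent-unique z-last u-last) z∈)
    ...     | inj₂ last-u = <⇒≱ (<-≤-trans (parent-< u-w) w≤last) (<⇒≤ (parent-< last-u))
    acyclic c | cons u~w path | _ ∷ (w∉ ∷ _) | _ | inj₁ w-u | inj₂ last-u =
      All¬⇒¬Any w∉ (subst (_∈ _) (parent-unique last-u w-u) (end-∈ path))
    acyclic c | cons u~w path | distinct@(u∉ ∷ _) | _ | inj₁ w-u | inj₁ u-last
      with ascending-then-descending w-u path distinct
    ... | inj₁ last<u = <⇒≱ last<u (<⇒≤ (parent-< u-last))
    ... | inj₂ (z , z-last , z∈) = All¬⇒¬Any u∉ (subst (_∈ _) (parent-unique z-last u-last) z∈)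

    walk-to-root : ∀ k (u r : Fin n) → toℕ r ≡ 0 → toℕ u ≤ k → Walk (tree n) u r
    walk-to-root k u r r≡0 u≤k with toℕ u in u≡
    ... | zero = subst (Walk (tree n) u) (toℕ-injective (trans u≡ (sym r≡0))) here
    walk-to-root (suc k) u r r≡0 (s≤s c≤k) | suc c =
      step u~p (walk-to-root k p r r≡0 (subst (_≤ k) (sym p≡) (≤-trans (≤-pred (parent< c)) c≤k)))
      where
        parent<n : parent (suc c) < n
        parent<n = <-trans (parent< c) (subst (_< n) u≡ (toℕ<n u))
        p : Fin n
        p = fromℕ< parent<n
        p≡ : toℕ p ≡ parent (suc c)
        p≡ = toℕ-fromℕ< parent<n
        u~p : Adj (tree n) u p
        u~p = subst₂ (λ a b → joined a b ≡ true) (sym u≡) (sym p≡)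
                     (cong (_∨ isChildOf (parent (suc c)) (suc c)) (dec-true (parent (suc c) ≟ parent (suc c)) refl))

    connected : Connected (tree n)
    connected u v = walk-++ (walk-to-root n u root root≡0 (<⇒≤ (toℕ<n u)))
                            (walk-reverse (walk-to-root n v root root≡0 (<⇒≤ (toℕ<n v))))
      where
        0<n : 0 < n
        0<n = ≤-trans (s≤s z≤n) (toℕ<n u)
        root : Fin n
        root = fromℕ< 0<n
        root≡0 : toℕ root ≡ 0
        root≡0 = toℕ-fromℕ< 0<n

  -- Degrees and F-index of `tree N` as functions on ℕ, so that `tree (suc N)` just adds the vertex N.
  degreeBelow : ℕ → ℕ → ℕ
  degreeBelow N v = sumBelow (indicator ∘ joined v) N

  FindexBelow : ℕ → ℕ
  FindexBelow N = sumBelow (λ v → degreeBelow N v ^ 3) N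

  degree-tree : ∀ N v → degree (tree N) v ≡ degreeBelow N (toℕ v)
  degree-tree N v = trans (degree≡sum (tree N) v) (sum-toℕ N (indicator ∘ joined (toℕ v)))

  Findex-tree : ∀ N → Findex (tree N) ≡ FindexBelow N
  Findex-tree N = begin
    Findex (tree N)                                 ≡⟨ sum-allFin (λ v → degree (tree N) v ^ 3) ⟩
    sum {N} (λ v → degree (tree N) v ^ 3)           ≡⟨ sum-cong-≗ {N} (λ v → cong (_^ 3) (degree-tree N v)) ⟩
    sum {N} (λ v → degreeBelow N (toℕ v) ^ 3)       ≡⟨ sum-toℕ N (λ v → degreeBelow N v ^ 3) ⟩
    FindexBelow N                                   ∎
    where open ≡-Reasoning

  degreeBelow-old : ∀ c v → v < suc c → degreeBelow (suc (suc c)) v ≡ degreeBelow (suc c) v + indicator (does (parent (suc c) ≟ v))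
  degreeBelow-old c v v<1+c = cong (λ b → degreeBelow (suc c) v + indicator (b ∨ _)) (isChildOf-≤ (<⇒≤ v<1+c))

  degreeBelow-new : ∀ c → degreeBelow (suc (suc c)) (suc c) ≡ 1
  degreeBelow-new c = begin
    degreeBelow (suc c) (suc c) + indicator (joined (suc c) (suc c))
      ≡⟨ cong₂ _+_ (sumBelow-cong (suc c) only-parent) (cong (λ b → indicator (b ∨ b)) (isChildOf-≤ {suc c} ≤-refl)) ⟩
    sumBelow (λ i → indicator (does (parent (suc c) ≟ i))) (suc c) + 0
      ≡⟨ trans (+-identityʳ _) (sumBelow-indicator (suc c) (parent< c)) ⟩
    1 ∎
    where
      open ≡-Reasoning
      only-parent : ∀ i → i < suc c → indicator (joined (suc c) i) ≡ indicator (does (parent (suc c) ≟ i))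
      only-parent i i<1+c =
        trans (cong (λ b → indicator (does (parent (suc c) ≟ i) ∨ b)) (isChildOf-≤ (<⇒≤ i<1+c)))
              (cong indicator (∨-identityʳ _))

  FindexBelow-step : ∀ c → let d = degreeBelow (suc c) (parent (suc c)) in
    FindexBelow (suc (suc c)) + d ^ 3 ≡ FindexBelow (suc c) + suc d ^ 3 + 1
  FindexBelow-step c = begin
    sumBelow (λ v → degreeBelow (2 + c) v ^ 3) (suc c) + degreeBelow (2 + c) (suc c) ^ 3 + d ^ 3
      ≡⟨ cong₂ (λ x y → x + y ^ 3 + d ^ 3) (sumBelow-cong (suc c) (λ v v<1+c → cong (_^ 3) (degreeBelow-old c v v<1+c)))
                                          (degreeBelow-new c) ⟩
    sumBelow (λ v → (degreeBelow (suc c) v + indicator (does (p ≟ v))) ^ 3) (suc c) + 1 + d ^ 3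
      ≡⟨ xy∙z≈xz∙y _ 1 (d ^ 3) ⟩
    sumBelow (λ v → (degreeBelow (suc c) v + indicator (does (p ≟ v))) ^ 3) (suc c) + d ^ 3 + 1
      ≡⟨ cong (_+ 1) (sumBelow-increment (_^ 3) (degreeBelow (suc c)) (suc c) (parent< c)) ⟩
    FindexBelow (suc c) + suc d ^ 3 + 1 ∎
    where
      open ≡-Reasoning
      p d : ℕ
      p = parent (suc c)
      d = degreeBelow (suc c) p

-- The F-index of trees with bounded degree

-- (1 + e)³ − 1, written without truncated subtraction.
cubeExcess : ℕ → ℕ
cubeExcess e = e * e * e + 3 * e * e + 3 * e

suc^3≡1+cubeExcess : ∀ e → suc e ^ 3 ≡ 1 + cubeExcess e
suc^3≡1+cubeExcess = expanded
  where
    expanded : ∀ e → (1 + e) * ((1 + e) * ((1 + e) * 1)) ≡ 1 + (e * e * e + 3 * e * e + 3 * e)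
    expanded = solve-∀

cubeExcess-convex : Convex cubeExcess
cubeExcess-convex k u v = subst (cubeExcess (k + u) + cubeExcess (k + v) ≤_) (identity k u v) (m≤m+n _ _)
  where
    identity : ∀ k u v →
      (k + u) * (k + u) * (k + u) + 3 * (k + u) * (k + u) + 3 * (k + u)
        + ((k + v) * (k + v) * (k + v) + 3 * (k + v) * (k + v) + 3 * (k + v))
        + 3 * u * v * (2 * k + 2 + u + v)
      ≡ k * k * k + 3 * k * k + 3 * k
        + ((k + u + v) * (k + u + v) * (k + u + v) + 3 * (k + u + v) * (k + u + v) + 3 * (k + u + v))
    identity = solve-∀

walk⇒degree≥1 : ∀ {n} (G : Graph n) {v u} → Walk G v u → v ≢ u → 1 ≤ degree G v
walk⇒degree≥1 G here v≢v = ⊥-elim (v≢v refl)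
walk⇒degree≥1 G {v} (step {w = w} v~w _) _ = begin
  1                                   ≡⟨ cong indicator (sym v~w) ⟩
  indicator (adj G v w)               ≤⟨ term≤sum (λ u → indicator (adj G v u)) w ⟩
  sum (λ u → indicator (adj G v u))   ≡⟨ sym (degree≡sum G v) ⟩
  degree G v                          ∎
  where open ≤-Reasoning

module _ {n} (G : Graph n) (degree≥1 : ∀ v → 1 ≤ degree G v) where

  excess : Fin n → ℕ
  excess v = degree G v ∸ 1

  degree≡1+excess : ∀ v → degree G v ≡ 1 + excess v
  degree≡1+excess v = sym (m+[n∸m]≡n (degree≥1 v))

  sum-degree≡n+∑excess : sum (degree G) ≡ n + sum excess
  sum-degree≡n+∑excess = begin
    sum (degree G)                 ≡⟨ sum-cong-≗ degree≡1+excess ⟩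
    sum (λ v → 1 + excess v)       ≡⟨ ∑-distrib-+ (λ _ → 1) excess ⟩
    sum {n} (λ _ → 1) + sum excess ≡⟨ cong (_+ sum excess) (sum-const-1 n) ⟩
    n + sum excess                 ∎
    where open ≡-Reasoning

  Findex≡n+∑cubeExcess : Findex G ≡ n + sum (cubeExcess ∘ excess)
  Findex≡n+∑cubeExcess = begin
    Findex G                                  ≡⟨ sum-allFin (λ v → degree G v ^ 3) ⟩
    sum (λ v → degree G v ^ 3)                ≡⟨ sum-cong-≗ (λ v → trans (cong (_^ 3) (degree≡1+excess v)) (suc^3≡1+cubeExcess (excess v))) ⟩
    sum (λ v → 1 + cubeExcess (excess v))     ≡⟨ ∑-distrib-+ (λ _ → 1) (cubeExcess ∘ excess) ⟩
    sum {n} (λ _ → 1) + sum (cubeExcess ∘ excess) ≡⟨ cong (_+ sum (cubeExcess ∘ excess)) (sum-const-1 n) ⟩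
    n + sum (cubeExcess ∘ excess)             ∎
    where open ≡-Reasoning

module _ (m : ℕ) .{{_ : NonZero m}} where

  open Majorisation cubeExcess cubeExcess-convex refl m

  connected⇒degree≥1 : ∀ {j} (T : Graph (2 + j)) → Connected T → ∀ v → 1 ≤ degree T v
  connected⇒degree≥1 T connected v = walk⇒degree≥1 T (connected v (other v)) (v≢other v)
    where
      other : ∀ {j} → Fin (2 + j) → Fin (2 + j)
      other zero    = suc zero
      other (suc _) = zero
      v≢other : ∀ {j} (v : Fin (2 + j)) → v ≢ other v
      v≢other zero    ()
      v≢other (suc _) ()

  Findex-upper-bound : ∀ j (T : Graph (2 + j)) → IsTree T → MaxDegreeAtMost T (suc m) → Findex T ≤ 2 + j + greedy j
  Findex-upper-bound j T (connected , acyclic) max-degree = begin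
    Findex T                          ≡⟨ Findex≡n+∑cubeExcess T degree≥1 ⟩
    2 + j + sum (cubeExcess ∘ e)      ≤⟨ +-monoʳ-≤ (2 + j) (sum-φ≤greedy e (λ v → ∸-monoˡ-≤ 1 (max-degree v))) ⟩
    2 + j + greedy (sum e)             ≤⟨ +-monoʳ-≤ (2 + j) (greedy-mono sum-e≤j) ⟩
    2 + j + greedy j                   ∎
    where
      open ≤-Reasoning
      degree≥1 : ∀ v → 1 ≤ degree T v
      degree≥1 = connected⇒degree≥1 T connected
      e : Fin (2 + j) → ℕ
      e = excess T degree≥1
      double-suc : ∀ j → 2 * (1 + j) ≡ 2 + j + j
      double-suc = solve-∀
      sum-e≤j : sum e ≤ j
      sum-e≤j = +-cancelˡ-≤ (2 + j) (sum e) j (begin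
        2 + j + sum e     ≡⟨ sym (sum-degree≡n+∑excess T degree≥1) ⟩
        sum (degree T)    ≤⟨ Forest.sum-degree≤2[n∸1] T acyclic ⟩
        2 * (1 + j)       ≡⟨ double-suc j ⟩
        2 + j + j         ∎)

  -- Vertex 1 hangs from 0 and vertex 2 + s from the hub s / m * m + 1. The hubs 1, m + 1, 2m + 1, …
  -- form a path and each gets m children, so every degree is 1 or m + 1 except that of the last hub.
  caterpillarParent : ℕ → ℕ
  caterpillarParent (suc (suc s)) = s / m * m + 1
  caterpillarParent _             = 0

  caterpillarParent< : ∀ c → caterpillarParent (suc c) < suc c
  caterpillarParent< zero    = s≤s z≤n
  caterpillarParent< (suc s) = s≤s (subst (_≤ suc s) (+-comm 1 _) (s≤s (m/n*n≤m s m)))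

  open RecursiveTree caterpillarParent caterpillarParent<

  hub : ℕ → ℕ
  hub s = s / m * m + 1

  record Invariant (s : ℕ) : Set where
    field
      hub-degree   : degreeBelow (2 + s) (hub s) ≡ suc (s % m)
      degree≤      : ∀ v → v < 2 + s → degreeBelow (2 + s) v ≤ suc m
      FindexBelow≡ : FindexBelow (2 + s) ≡ 2 + s + greedy s

  module InvariantStep (s : ℕ) (I : Invariant s) where

    open Invariant I

    private
      r : ℕ
      r = s % m

    degree-old : ∀ v → v < 2 + s → degreeBelow (3 + s) v ≡ degreeBelow (2 + s) v + indicator (does (hub s ≟ v))
    degree-old = degreeBelow-old (suc s)

    hub-degree-old : degreeBelow (3 + s) (hub s) ≡ suc (suc r)
    hub-degree-old = begin
      degreeBelow (3 + s) (hub s)                                    ≡⟨ degree-old (hub s) (caterpillarParent< (suc s)) ⟩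
      degreeBelow (2 + s) (hub s) + indicator (does (hub s ≟ hub s)) ≡⟨ cong₂ _+_ hub-degree (indicator-≟-refl (hub s)) ⟩
      suc r + 1                                                      ≡⟨ +-comm (suc r) 1 ⟩
      suc (suc r)                                                    ∎
      where open ≡-Reasoning

    degree≤′ : ∀ v → v < 3 + s → degreeBelow (3 + s) v ≤ suc m
    degree≤′ v v<3+s with m<1+n⇒m<n∨m≡n v<3+s
    ... | inj₂ refl = ≤-trans (≤-reflexive (degreeBelow-new (suc s))) (s≤s z≤n)
    ... | inj₁ v<2+s with hub s ≟ v
    ...   | yes refl = ≤-trans (≤-reflexive hub-degree-old) (s≤s (m%n<n s m))
    ...   | no hub≢v = ≤-trans (≤-reflexive degree-unchanged) (degree≤ v v<2+s)
      where
        degree-unchanged : degreeBelow (3 + s) v ≡ degreeBelow (2 + s) v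
        degree-unchanged = trans (degree-old v v<2+s)
          (trans (cong (λ i → degreeBelow (2 + s) v + i) (indicator-≟-≢ hub≢v)) (+-identityʳ _))

    hub-degree′ : degreeBelow (3 + s) (hub (suc s)) ≡ suc (suc s % m)
    hub-degree′ with suc-quotient-remainder s m
    ... | inj₁ (_ , q≡ , r≡) = begin
      degreeBelow (3 + s) (hub (suc s)) ≡⟨ cong (λ q → degreeBelow (3 + s) (q * m + 1)) q≡ ⟩
      degreeBelow (3 + s) (hub s)       ≡⟨ hub-degree-old ⟩
      suc (suc r)                       ≡⟨ cong suc (sym r≡) ⟩
      suc (suc s % m)                   ∎
      where open ≡-Reasoning
    ... | inj₂ (r+1≡m , q≡ , r≡) = begin
      degreeBelow (3 + s) (hub (suc s)) ≡⟨ cong (degreeBelow (3 + s)) hub≡ ⟩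
      degreeBelow (3 + s) (2 + s)       ≡⟨ degreeBelow-new (suc s) ⟩
      1                                 ≡⟨ cong suc (sym r≡) ⟩
      suc (suc s % m)                   ∎
      where
        open ≡-Reasoning
        hub≡ : hub (suc s) ≡ 2 + s
        hub≡ = begin
          suc s / m * m + 1         ≡⟨ cong (λ q → q * m + 1) q≡ ⟩
          m + s / m * m + 1         ≡⟨ cong (_+ 1) (+-comm m _) ⟩
          s / m * m + m + 1         ≡⟨ cong (λ k → s / m * m + k + 1) (sym r+1≡m) ⟩
          s / m * m + suc r + 1     ≡⟨ cong (_+ 1) (+-suc _ r) ⟩
          suc (s / m * m + r) + 1   ≡⟨ cong (λ k → suc k + 1) (sym (decompose s m)) ⟩
          suc s + 1                 ≡⟨ +-comm (suc s) 1 ⟩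
          2 + s                     ∎

    FindexBelow≡′ : FindexBelow (3 + s) ≡ 3 + s + greedy (suc s)
    FindexBelow≡′ = +-cancelʳ-≡ (1 + cubeExcess r) _ _ (begin
      FindexBelow (3 + s) + (1 + cubeExcess r)             ≡⟨ cube-step ⟩
      FindexBelow (2 + s) + (1 + cubeExcess (suc r)) + 1   ≡⟨ cong (λ F → F + (1 + cubeExcess (suc r)) + 1) FindexBelow≡ ⟩
      2 + s + greedy s + (1 + cubeExcess (suc r)) + 1      ≡⟨ regroup₁ s (greedy s) (cubeExcess (suc r)) ⟩
      3 + s + (greedy s + cubeExcess (suc r)) + 1          ≡⟨ cong (λ t → 3 + s + t + 1) (sym (greedy-suc s)) ⟩
      3 + s + (greedy (suc s) + cubeExcess r) + 1          ≡⟨ regroup₂ s (greedy (suc s)) (cubeExcess r) ⟩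
      3 + s + greedy (suc s) + (1 + cubeExcess r)          ∎)
      where
        open ≡-Reasoning
        cube-step : FindexBelow (3 + s) + (1 + cubeExcess r) ≡ FindexBelow (2 + s) + (1 + cubeExcess (suc r)) + 1
        cube-step = subst₂ (λ x y → FindexBelow (3 + s) + x ≡ FindexBelow (2 + s) + y + 1)
                      (suc^3≡1+cubeExcess r) (suc^3≡1+cubeExcess (suc r))
                      (subst (λ d → FindexBelow (3 + s) + d ^ 3 ≡ FindexBelow (2 + s) + suc d ^ 3 + 1) hub-degree
                             (FindexBelow-step (suc s)))
        regroup₁ : ∀ s b y → 2 + s + b + (1 + y) + 1 ≡ 3 + s + (b + y) + 1
        regroup₁ = solve-∀
        regroup₂ : ∀ s b x → 3 + s + (b + x) + 1 ≡ 3 + s + b + (1 + x)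
        regroup₂ = solve-∀

  invariant : ∀ s → Invariant s
  invariant zero = record
    { hub-degree   = subst₂ (λ q r → degreeBelow 2 (q * m + 1) ≡ suc r) (sym (0/n≡0 m)) (sym (m<n⇒m%n≡m 0<m))
                       (degreeBelow-new 0)
    ; degree≤      = λ { 0 _ → s≤s z≤n ; 1 _ → s≤s z≤n ; (suc (suc _)) (s≤s (s≤s ())) }
    ; FindexBelow≡ = cong (λ t → 2 + t) (sym (greedy-≡ 0 0<m)) }
    where
      0<m : 0 < m
      0<m = >-nonZero⁻¹ m
  invariant (suc s) = record { hub-degree = hub-degree′ ; degree≤ = degree≤′ ; FindexBelow≡ = FindexBelow≡′ }
    where open InvariantStep s (invariant s)

  caterpillar : ∀ j → Graph (2 + j)
  caterpillar j = tree (2 + j)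

  caterpillar-isTree : ∀ j → IsTree (caterpillar j)
  caterpillar-isTree j = connected , acyclic

  caterpillar-maxDegree : ∀ j → MaxDegreeAtMost (caterpillar j) (suc m)
  caterpillar-maxDegree j v =
    ≤-trans (≤-reflexive (degree-tree (2 + j) v)) (Invariant.degree≤ (invariant j) (toℕ v) (toℕ<n v))

  caterpillar-Findex : ∀ j → Findex (caterpillar j) ≡ 2 + j + greedy j
  caterpillar-Findex j = trans (Findex-tree (2 + j)) (Invariant.FindexBelow≡ (invariant j))

  Findex-maximal : ∀ j (T : Graph (2 + j)) → IsTree T → MaxDegreeAtMost T (suc m) →
    ((T′ : Graph (2 + j)) → IsTree T′ → MaxDegreeAtMost T′ (suc m) → Findex T′ ≤ Findex T) →
    Findex T ≡ 2 + j + greedy j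
  Findex-maximal j T isTree maxDegree maximal = ≤-antisym (Findex-upper-bound j T isTree maxDegree)
    (subst (_≤ Findex T) (caterpillar-Findex j) (maximal (caterpillar j) (caterpillar-isTree j) (caterpillar-maxDegree j)))

-- Writing out the extremal value

∣[+a]-[+b]∣≡∣a-b∣ : ∀ a b → ℤ.∣ + a ℤ.- + b ∣ ≡ ∣ a - b ∣
∣[+a]-[+b]∣≡∣a-b∣ a b with ≤-total b a
... | inj₁ b≤a = trans (cong ℤ.∣_∣ (trans (ℤP.[+m]-[+n]≡m⊖n a b) (ℤP.⊖-≥ b≤a)))
                       (sym (trans (∣-∣-comm a b) (m≤n⇒∣m-n∣≡n∸m b≤a)))
... | inj₂ a≤b = trans (cong ℤ.∣_∣ (ℤP.[+m]-[+n]≡m⊖n a b))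
                       (trans (ℤP.∣m⊖n∣≡∣n⊖m∣ a b) (trans (cong ℤ.∣_∣ (ℤP.⊖-≥ a≤b)) (sym (m≤n⇒∣m-n∣≡n∸m a≤b))))

residues-equal : ∀ {m x y} → x < m → y < m → m ∣ ∣ x - y ∣ → x ≡ y
residues-equal {m} {x} {y} x<m y<m m∣x-y with ∣ x - y ∣ in x-y≡
... | zero  = ∣m-n∣≡0⇒m≡n x-y≡
... | suc d = ⊥-elim (>⇒∤ (subst (_< m) x-y≡ (≤-<-trans (∣m-n∣≤m⊔n x y) (⊔-pres-<m x<m y<m))) m∣x-y)

∣-difference : ∀ {m a x y} → + m ℤd.∣ (+ a ℤ.- + x) → + m ℤd.∣ (+ a ℤ.- + y) → m ∣ ∣ y - x ∣
∣-difference {m} {a} {x} {y} m∣a-x m∣a-y = subst (m ∣_) (∣[+a]-[+b]∣≡∣a-b∣ y x)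
  (ℤs.∣⇒∣ᵤ (subst (ℤs._∣_ (+ m)) (difference (+ a) (+ x) (+ y))
    (ℤs.∣m∣n⇒∣m-n (ℤs.∣ᵤ⇒∣ {+ m} {+ a ℤ.- + x} m∣a-x) (ℤs.∣ᵤ⇒∣ {+ m} {+ a ℤ.- + y} m∣a-y))))
  where
    difference : ∀ a x y → (a ℤ.- x) ℤ.- (a ℤ.- y) ≡ y ℤ.- x
    difference = ℤ-Solver.solve-∀

ℕ-identity⇒ℤ : ∀ {a b c d e f} → a + b * c ≡ d * e + f → + a ≡ + d ℤ.* + e ℤ.- + b ℤ.* + c ℤ.+ + f
ℕ-identity⇒ℤ {a} {b} {c} {d} {e} {f} eq = begin
  + a                                     ≡⟨ cancel (+ a) (+ (b * c)) ⟩
  + a ℤ.+ + (b * c) ℤ.- + (b * c)         ≡⟨ cong (ℤ._- + (b * c)) (sym (ℤP.pos-+ a (b * c))) ⟩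
  + (a + b * c) ℤ.- + (b * c)             ≡⟨ cong (λ t → + t ℤ.- + (b * c)) eq ⟩
  + (d * e + f) ℤ.- + (b * c)             ≡⟨ cong₂ ℤ._-_ (trans (ℤP.pos-+ (d * e) f) (cong (ℤ._+ + f) (ℤP.pos-* d e))) (ℤP.pos-* b c) ⟩
  + d ℤ.* + e ℤ.+ + f ℤ.- + b ℤ.* + c     ≡⟨ swap (+ d ℤ.* + e) (+ f) (+ b ℤ.* + c) ⟩
  + d ℤ.* + e ℤ.- + b ℤ.* + c ℤ.+ + f     ∎
  where
    open ≡-Reasoning
    cancel : ∀ x y → x ≡ x ℤ.+ y ℤ.- y
    cancel = ℤ-Solver.solve-∀
    swap : ∀ x y z → x ℤ.+ y ℤ.- z ≡ x ℤ.- z ℤ.+ y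
    swap = ℤ-Solver.solve-∀

module _ (m : ℕ) .{{_ : NonZero m}} (j : ℕ) where

  open Majorisation cubeExcess cubeExcess-convex refl m using (greedy)

  private
    q r : ℕ
    q = j / m
    r = j % m

  extremal-value-divisible : m ∣ j → 2 + j + greedy j ≡ suc m * (suc m + 1) * j + 2 * suc j
  extremal-value-divisible m∣j = begin
    2 + j + (q * cubeExcess m + cubeExcess r) ≡⟨ cong (λ t → 2 + j + (q * cubeExcess m + cubeExcess t)) (n∣m⇒m%n≡0 j m m∣j) ⟩
    2 + j + (q * cubeExcess m + cubeExcess 0) ≡⟨ subst (λ t → 2 + t + (q * cubeExcess m + 0) ≡ suc m * (suc m + 1) * t + 2 * suc t)
                                                      (m/n*n≡m m∣j) (identity q m) ⟩
    suc m * (suc m + 1) * j + 2 * suc j       ∎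
    where
      open ≡-Reasoning
      identity : ∀ q m → 2 + q * m + (q * (m * m * m + 3 * m * m + 3 * m) + 0)
                       ≡ (1 + m) * ((1 + m) + 1) * (q * m) + 2 * (1 + q * m)
      identity = solve-∀

  extremal-value-residue-form : let Δ = suc m ; x = suc r in
    + (2 + j + greedy j) ≡ + (Δ ^ 2 + Δ + 2) ℤ.* + suc j ℤ.- + (Δ ^ 2 + Δ + 1) ℤ.* + x ℤ.+ + (x ^ 3)
  extremal-value-residue-form = ℕ-identity⇒ℤ {2 + j + greedy j} {Δ ^ 2 + Δ + 1} {suc r} {Δ ^ 2 + Δ + 2} {suc j} {suc r ^ 3} (begin
    2 + j + (q * cubeExcess m + cubeExcess r) + (Δ ^ 2 + Δ + 1) * suc r
      ≡⟨ cong (λ t → 2 + t + (q * cubeExcess m + cubeExcess r) + (Δ ^ 2 + Δ + 1) * suc r) (decompose j m) ⟩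
    2 + (q * m + r) + (q * cubeExcess m + cubeExcess r) + (Δ ^ 2 + Δ + 1) * suc r
      ≡⟨ identity q m r ⟩
    (Δ ^ 2 + Δ + 2) * suc (q * m + r) + suc r ^ 3
      ≡⟨ cong (λ t → (Δ ^ 2 + Δ + 2) * suc t + suc r ^ 3) (sym (decompose j m)) ⟩
    (Δ ^ 2 + Δ + 2) * suc j + suc r ^ 3 ∎)
    where
      open ≡-Reasoning
      Δ : ℕ
      Δ = suc m
      identity : ∀ q m r →
        2 + (q * m + r) + (q * (m * m * m + 3 * m * m + 3 * m) + (r * r * r + 3 * r * r + 3 * r))
          + ((1 + m) * ((1 + m) * 1) + (1 + m) + 1) * (1 + r)
        ≡ ((1 + m) * ((1 + m) * 1) + (1 + m) + 2) * (1 + (q * m + r)) + (1 + r) * ((1 + r) * ((1 + r) * 1))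
      identity = solve-∀

  remainder+1≥2 : ¬ m ∣ j → 2 ≤ suc r
  remainder+1≥2 m∤j = s≤s (n≢0⇒n>0 (λ r≡0 → m∤j (m%n≡0⇒n∣m j m r≡0)))

  remainder+1-congruent : + m ℤd.∣ (+ suc j ℤ.- + suc r)
  remainder+1-congruent = subst (m ∣_) (sym (begin
    ℤ.∣ + suc j ℤ.- + suc r ∣ ≡⟨ ∣[+a]-[+b]∣≡∣a-b∣ (suc j) (suc r) ⟩
    ∣ j - r ∣                 ≡⟨ trans (∣-∣-comm j r) (m≤n⇒∣m-n∣≡n∸m (m%n≤m j m)) ⟩
    j ∸ r                     ≡⟨ cong (_∸ r) (decompose j m) ⟩
    q * m + r ∸ r             ≡⟨ m+n∸n≡m (q * m) r ⟩
    q * m                     ∎)) (n∣m*n q)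
    where open ≡-Reasoning

  remainder+1-unique : ∀ y → 1 ≤ y → y ≤ m → + m ℤd.∣ (+ suc j ℤ.- + y) → y ≡ suc r
  remainder+1-unique (suc y′) _ y′<m m∣[1+j]-y =
    cong suc (residues-equal y′<m (m%n<n j m) (∣-difference {m} {suc j} {suc r} {suc y′} remainder+1-congruent m∣[1+j]-y))

corollary1 : (n Δ : ℕ) → 2 ≤ n → 2 ≤ Δ →
    (T : Graph n) → IsTree T → MaxDegreeAtMost T Δ →
    ((T′ : Graph n) → IsTree T′ → MaxDegreeAtMost T′ Δ → Findex T′ ≤ Findex T) →
    ((Δ ∸ 1) ∣ (n ∸ 2) → Findex T ≡ Δ * (Δ + 1) * (n ∸ 2) + 2 * (n ∸ 1))
    × (¬ ((Δ ∸ 1) ∣ (n ∸ 2)) →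
       Σ ℕ (λ x → (2 ≤ x × x ≤ Δ ∸ 1 × + (Δ ∸ 1) ℤd.∣ (+ (n ∸ 1) ℤ.- + x))
         × (+ Findex T ≡ (+ (Δ ^ 2 + Δ + 2) ℤ.* + (n ∸ 1)) ℤ.- (+ (Δ ^ 2 + Δ + 1) ℤ.* + x) ℤ.+ + (x ^ 3))
         × ((y : ℕ) → 2 ≤ y → y ≤ Δ ∸ 1 → + (Δ ∸ 1) ℤd.∣ (+ (n ∸ 1) ℤ.- + y) → y ≡ x)))
corollary1 (suc (suc j)) (suc (suc m′)) (s≤s (s≤s _)) (s≤s (s≤s _)) T isTree maxDegree maximal =
  (λ m∣j → trans Findex≡ (extremal-value-divisible m j m∣j)) ,
  (λ m∤j → suc (j % m)
         , (remainder+1≥2 m j m∤j , m%n<n j m , remainder+1-congruent m j)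
         , trans (cong +_ Findex≡) (extremal-value-residue-form m j)
         , λ y 2≤y → remainder+1-unique m j y (<⇒≤ 2≤y))
  where
    m : ℕ
    m = suc m′
    Findex≡ : Findex T ≡ 2 + j + Majorisation.greedy cubeExcess cubeExcess-convex refl m j
    Findex≡ = Findex-maximal m j T isTree maxDegree maximal
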